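{- Let $\tau$ be a valuation satisfying $\mathsf{Cl}(\Gamma)$. If $C,D\in\mathsf{At}$ with $\tau([C\sqsubseteq D])=1$, then $\sigma_\tau(C)\sqsubseteq\sigma_\tau(D)$.
   Context: $\mathcal{EL}$ concept terms are built from concept names and role names using $C\sqcap D$, $\exists r.C$ and $\top$; $C\sqsubseteq D$ means $C^{\mathcal I}\subseteq D^{\mathcal I}$ in every interpretation. Concept names are split into variables $N_v$ and constants $N_c$. $\Gamma$ is a flat disunification problem: subsumptions $C_1\sqcap\dots\sqcap C_n\sqsubseteq^? D$ of flat atoms (concept names or $\exists r.A$, $A$ a concept name) and dissubsumptions, all of which are of the form $X\not\sqsubseteq^? Y$ with variables $X,Y$; $N_v,N_c,N_R$ are exactly the variables, constants and roles occurring in $\Gamma$. $\mathsf{At}$ = atoms occurring as subterms of $\Gamma$, $\mathsf{At_{nv}}=\mathsf{At}\setminus N_v$. $\mathsf{Cl}(\Gamma)$ is the clause set over propositional variables $[C\sqsubseteq D]$ ($C,D\in\mathsf{At}$), $[X>Y]$ ($X,Y\in N_v$), $p_{C,X,D}$ ($C\in\mathsf{At}$, $X\in N_v$, $D\in\mathsf{At_{nv}}$): (Ia) for each $C_1\sqcap\dots\sqcap C_n\sqsubseteq^? D$ in $\Gamma$ with $D\in\mathsf{At_{nv}}$: $[C_1\sqsubseteq D]\lor\dots\lor[C_n\sqsubseteq D]$; (Ib) for each $C_1\sqcap\dots\sqcap C_n\sqsubseteq^? X$ in $\Gamma$, $X\in N_v$, and each $E\in\mathsf{At_{nv}}$: $[X\sqsubseteq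 E]\to[C_1\sqsubseteq E]\lor\dots\lor[C_n\sqsubseteq E]$; (Ic) for each $X\not\sqsubseteq^? Y$ in $\Gamma$: $\lnot[X\sqsubseteq Y]$; (IIa) $[A\sqsubseteq A]$ for $A\in N_c$; (IIb) $\lnot[A\sqsubseteq B]$ for distinct $A,B\in N_c$; (IIc) $\lnot[\exists r.A\sqsubseteq\exists s.B]$ for $\exists r.A,\exists s.B\in\mathsf{At_{nv}}$, $r\ne s$; (IId) $\lnot[A\sqsubseteq\exists r.B]$ and $\lnot[\exists r.B\sqsubseteq A]$ for $A\in N_c$, $\exists r.B\in\mathsf{At_{nv}}$; (IIe) $[\exists r.A\sqsubseteq\exists r.B]\to[A\sqsubseteq B]$ and $[A\sqsubseteq B]\to[\exists r.A\sqsubseteq\exists r.B]$ for $\exists r.A,\exists r.B\in\mathsf{At_{nv}}$; (III) $[C_1\sqsubseteq C_2]\land[C_2\sqsubseteq C_3]\to[C_1\sqsubseteq C_3]$ for $C_1,C_2,C_3\in\mathsf{At}$; (IV) for $C\in\mathsf{At}$, $X\in N_v$: $[C\sqsubseteq X]\lor\bigvee_{D\in\mathsf{At_{nv}}}p_{C,X,D}$, and for each $D\in\mathsf{At_{nv}}$: $p_{C,X,D}\to[X\sqsubseteq D]$ and $\lnot(p_{C,X,D}\land[C\sqsubseteq D])$; (Va) $\lnot[X>X]$; (Vb) $[X>Y]\land[Y>Z]\to[X>Z]$; (Vc) $[X\sqsubseteq\exists r.Y]\to[X>Y]$ for $X,Y\in N_v$ with $\exists r.Y\in\mathsf{At}$.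 For a satisfying $\tau$, let $S^\tau_X:=\{D\in\mathsf{At_{nv}}\mid\tau([X\sqsubseteq D])=1\}$; the relation $>_{S^\tau}$ (transitive closure of $\{(X,Y)\mid Y\text{ occurs in an atom of }S^\tau_X\}$) is irreflexive, so $S^\tau$ is acyclic and $\sigma_\tau$ is defined inductively by $\sigma_\tau(X):=\sigma_\tau(D_1)\sqcap\dots\sqcap\sigma_\tau(D_k)$ for $S^\tau_X=\{D_1,\dots,D_k\}$ ($\top$ if empty), ground atoms being unchanged. -}

module Defs where

open import Data.Nat using (ℕ; zero; suc)
open import Data.Bool using (Bool; true; false; not)
open import Data.List using (List; []; _∷_; _++_; map; concatMap; filterᵇ; length)
open import Data.List.Membership.Propositional using (_∈_)
open import Data.List.Relation.Unary.Any using (Any)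
open import Data.Product using (Σ; _×_; _,_)
open import Data.Sum using (_⊎_)
open import Data.Unit using (⊤)
open import Relation.Binary.PropositionalEquality using (_≡_; _≢_)
open import Relation.Nullary using (¬_)

data Name : Set where
  var : ℕ → Name
  con : ℕ → Name

data Concept : Set where
  name : Name → Concept
  ⊤ᶜ   : Concept
  _⊓_  : Concept → Concept → Concept
  ∃ᶜ   : ℕ → Concept → Concept

record Interpretation : Set₁ where
  field
    Δ     : Set
    nameI : Name → Δ → Set
    roleI : ℕ → Δ → Δ → Set

open Interpretation public

⟦_⟧ : Concept → (I : Interpretation) → Δ I → Set
⟦ name A ⟧  I x = nameI I A x
⟦ ⊤ᶜ ⟧      I x = ⊤
⟦ C ⊓ D ⟧   I x = ⟦ C ⟧ I x × ⟦ D ⟧ I x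
⟦ ∃ᶜ r C ⟧  I x = Σ (Δ I) λ y → roleI I r x y × ⟦ C ⟧ I y

_⊑_ : Concept → Concept → Set₁
C ⊑ D = (I : Interpretation) (x : Δ I) → ⟦ C ⟧ I x → ⟦ D ⟧ I x

data Atom : Set where
  atN  : Name → Atom
  atEx : ℕ → Name → Atom

nonVar : Atom → Bool
nonVar (atN (var _)) = false
nonVar (atN (con _)) = true
nonVar (atEx _ _)    = true

-- flat subsumption  C₁ ⊓ … ⊓ Cₙ ⊑? D
record Subs : Set where
  constructor _⊑?_
  field
    lhs : List Atom
    rhs : Atom

-- flat disunification problem: subsumptions and dissubsumptions X ⋢? Y
-- (each dissubsumption is a pair of variable indices (X , Y)).
record Problem : Set where
  field
    subs : List Subs
    diss : List (ℕ × ℕ)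

open Subs public
open Problem public

subAtoms : Atom → List Atom
subAtoms (atN A)    = atN A ∷ []
subAtoms (atEx r A) = atEx r A ∷ atN A ∷ []

At : Problem → List Atom
At Γ = concatMap (λ s → concatMap subAtoms (rhs s ∷ lhs s)) (subs Γ)
    ++ concatMap (λ { (X , Y) → atN (var X) ∷ atN (var Y) ∷ [] }) (diss Γ)

AtNv : Problem → List Atom
AtNv Γ = filterᵇ nonVar (At Γ)

_∈At_ : Atom → Problem → Set
C ∈At Γ = C ∈ At Γ

_∈Atnv_ : Atom → Problem → Set
C ∈Atnv Γ = C ∈ At Γ × nonVar C ≡ true

-- X ∈ N_v  (every occurring variable occurs as an atom of At)
_∈Nv_ : ℕ → Problem → Set
X ∈Nv Γ = atN (var X) ∈ At Γ

_∈Nc_ : ℕ → Problem → Set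
A ∈Nc Γ = atN (con A) ∈ At Γ

-- Valuations of the propositional variables
--   [C ⊑ D]  ↦ sub C D,   [X > Y] ↦ gt X Y,   p_{C,X,D} ↦ p C X D

record Valuation : Set where
  field
    sub : Atom → Atom → Bool
    gt  : ℕ → ℕ → Bool
    p   : Atom → ℕ → Atom → Bool

open Valuation public

record Satisfies (Γ : Problem) (τ : Valuation) : Set where
  field
    Ia  : ∀ s → s ∈ subs Γ → nonVar (rhs s) ≡ true →
          Any (λ C → sub τ C (rhs s) ≡ true) (lhs s)
    Ib  : ∀ s X → s ∈ subs Γ → rhs s ≡ atN (var X) →
          ∀ E → E ∈Atnv Γ → sub τ (atN (var X)) E ≡ true →
          Any (λ C → sub τ C E ≡ true) (lhs s)
    Ic  : ∀ X Y → (X , Y) ∈ diss Γ → sub τ (atN (var X)) (atN (var Y)) ≡ false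
    IIa : ∀ A → A ∈Nc Γ → sub τ (atN (con A)) (atN (con A)) ≡ true
    IIb : ∀ A B → A ∈Nc Γ → B ∈Nc Γ → A ≢ B →
          sub τ (atN (con A)) (atN (con B)) ≡ false
    IIc : ∀ r A s B → atEx r A ∈At Γ → atEx s B ∈At Γ → r ≢ s →
          sub τ (atEx r A) (atEx s B) ≡ false
    IId₁ : ∀ A r B → A ∈Nc Γ → atEx r B ∈At Γ →
           sub τ (atN (con A)) (atEx r B) ≡ false
    IId₂ : ∀ A r B → A ∈Nc Γ → atEx r B ∈At Γ →
           sub τ (atEx r B) (atN (con A)) ≡ false
    IIe₁ : ∀ r A B → atEx r A ∈At Γ → atEx r B ∈At Γ →
           sub τ (atEx r A) (atEx r B) ≡ true → sub τ (atN A) (atN B) ≡ true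
    IIe₂ : ∀ r A B → atEx r A ∈At Γ → atEx r B ∈At Γ →
           sub τ (atN A) (atN B) ≡ true → sub τ (atEx r A) (atEx r B) ≡ true
    III : ∀ C₁ C₂ C₃ → C₁ ∈At Γ → C₂ ∈At Γ → C₃ ∈At Γ →
          sub τ C₁ C₂ ≡ true → sub τ C₂ C₃ ≡ true → sub τ C₁ C₃ ≡ true
    IV₁ : ∀ C X → C ∈At Γ → X ∈Nv Γ →
          sub τ C (atN (var X)) ≡ true
          ⊎ Σ Atom (λ D → D ∈Atnv Γ × p τ C X D ≡ true)
    IV₂ : ∀ C X D → C ∈At Γ → X ∈Nv Γ → D ∈Atnv Γ →
          p τ C X D ≡ true → sub τ (atN (var X)) D ≡ true
    IV₃ : ∀ C X D → C ∈At Γ → X ∈Nv Γ → D ∈Atnv Γ →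
          ¬ (p τ C X D ≡ true × sub τ C D ≡ true)
    Va  : ∀ X → X ∈Nv Γ → gt τ X X ≡ false
    Vb  : ∀ X Y Z → X ∈Nv Γ → Y ∈Nv Γ → Z ∈Nv Γ →
          gt τ X Y ≡ true → gt τ Y Z ≡ true → gt τ X Z ≡ true
    Vc  : ∀ X r Y → X ∈Nv Γ → Y ∈Nv Γ → atEx r (var Y) ∈At Γ →
          sub τ (atN (var X)) (atEx r (var Y)) ≡ true → gt τ X Y ≡ true

-- The substitution σ_τ.
-- σ_τ(X) = ⊓ { σ_τ(D) | D ∈ S^τ_X },  S^τ_X = { D ∈ At_nv | τ([X ⊑ D]) = 1 },
-- ground atoms unchanged.  The inductive definition (well-founded since
-- >_{S^τ} is acyclic) is realised by recursion with a fuel bound; any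
-- fuel ≥ |N_v| gives exactly the inductive definition, and we use |At|.

conj : List Concept → Concept
conj []       = ⊤ᶜ
conj (C ∷ Cs) = C ⊓ conj Cs

S : Problem → Valuation → ℕ → List Atom
S Γ τ X = filterᵇ (sub τ (atN (var X))) (AtNv Γ)

module _ (Γ : Problem) (τ : Valuation) where
  mutual
    σvarF : ℕ → ℕ → Concept
    σvarF zero    X = ⊤ᶜ
    σvarF (suc k) X = conj (map (σatomF k) (S Γ τ X))

    σatomF : ℕ → Atom → Concept
    σatomF k (atN (var X))    = σvarF k X
    σatomF k (atN (con A))    = name (con A)
    σatomF k (atEx r (var Y)) = ∃ᶜ r (σvarF k Y)
    σatomF k (atEx r (con A)) = ∃ᶜ r (name (con A))

σ : Problem → Valuation → Atom → Concept
σ Γ τ C = σatomF Γ τ (length (At Γ)) C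

-- Since τ satisfies (Va), (Vb) and (Vc), the relation [X > Y] is a strict
-- order on the variables that contains every step X → Y with ∃r.Y ∈ S^τ_X; a
-- descending chain therefore visits distinct variables and is shorter than
-- |At|. Hence the fuel |At| used to define σ_τ is never exhausted, and
-- σ_τ(X) unfolds to the conjunction of σ_τ over S^τ_X. With this unfolding,
-- a subsumption τ([C ⊑ D]) = 1 is verified by cases: a variable on the right
-- splits into the atoms E ∈ S^τ_Y, reached from C by transitivity (III); a
-- variable on the left contains the conjunct σ_τ(D); for constants and
-- existentials the clauses (IIb–IIe) leave only A ⊑ A and ∃r.A ⊑ ∃r.B with
-- τ([A ⊑ B]) = 1, the latter by the case of concept names.
module Submission where

open import Defs
open import Data.Bool using (Bool; true)
open import Data.Bool.Properties using (T-≡; not-¬)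
open import Data.Empty using (⊥; ⊥-elim)
open import Data.List using (List; []; _∷_; map; concatMap; filterᵇ; length)
open import Data.List.Membership.Propositional using (_∈_)
open import Data.List.Membership.Propositional.Properties
  using (∈-filter⁺; ∈-filter⁻; ∈-concatMap⁺; ∈-concatMap⁻; ∈-++⁺ˡ; ∈-++⁻)
open import Data.List.Properties using (map-cong-local; length-removeAt′)
open import Data.List.Relation.Unary.All using (tabulate)
open import Data.List.Relation.Unary.Any using (Any; here; there; index; _─_)
import Data.List.Relation.Unary.Any as Any
open import Data.Nat using (ℕ; zero; suc; _<_; s≤s; z≤n)
import Data.Nat as ℕ
open import Data.Nat.Properties using (<-irrefl)
open import Data.Product using (Σ; _×_; _,_; proj₁)
open import Data.Sum using (_⊎_; inj₁; inj₂)
open import Data.Unit using (tt)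
open import Function using (_∘_; Equivalence)
open import Relation.Binary.PropositionalEquality using (_≡_; _≢_; refl; sym; cong; subst)
open import Relation.Nullary using (¬_; yes; no)
open import Relation.Nullary.Decidable.Core using (T?)

private
  variable
    A : Set

∈-filterᵇ⁺ : (p : A → Bool) {x : A} {xs : List A} →
             x ∈ xs → p x ≡ true → x ∈ filterᵇ p xs
∈-filterᵇ⁺ p x∈xs px = ∈-filter⁺ (T? ∘ p) x∈xs (Equivalence.from T-≡ px)

∈-filterᵇ⁻ : (p : A → Bool) {x : A} {xs : List A} →
             x ∈ filterᵇ p xs → x ∈ xs × p x ≡ true
∈-filterᵇ⁻ p x∈ with ∈-filter⁻ (T? ∘ p) x∈
... | x∈xs , px = x∈xs , Equivalence.to T-≡ px

∈-─⁺ : {x z : A} {xs : List A} (x∈xs : x ∈ xs) → z ∈ xs → z ≢ x → z ∈ (xs ─ x∈xs)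
∈-─⁺ (here refl) (here refl)  z≢x = ⊥-elim (z≢x refl)
∈-─⁺ (here refl) (there z∈xs) z≢x = z∈xs
∈-─⁺ (there x∈xs) (here z≡y)  z≢x = here z≡y
∈-─⁺ (there x∈xs) (there z∈xs) z≢x = there (∈-─⁺ x∈xs z∈xs z≢x)

⊑-refl : (C : Concept) → C ⊑ C
⊑-refl C I x Cx = Cx

∃-mono : (r : ℕ) {C D : Concept} → C ⊑ D → ∃ᶜ r C ⊑ ∃ᶜ r D
∃-mono r C⊑D I x (y , xry , Cy) = y , xry , C⊑D I y Cy

conj-⊑ : (f : A → Concept) {xs : List A} {x : A} → x ∈ xs → conj (map f xs) ⊑ f x
conj-⊑ f (here refl) I d (fx , _)    = fx
conj-⊑ f (there x∈xs) I d (_ , fxs) = conj-⊑ f x∈xs I d fxs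

⊑-conj : (f : A → Concept) (xs : List A) (C : Concept) →
         (∀ {x} → x ∈ xs → C ⊑ f x) → C ⊑ conj (map f xs)
⊑-conj f []       C C⊑f I d Cd = tt
⊑-conj f (x ∷ xs) C C⊑f I d Cd = C⊑f (here refl) I d Cd , ⊑-conj f xs C (C⊑f ∘ there) I d Cd

∃-subAtoms : {r : ℕ} {B : Name} (C : Atom) → atEx r B ∈ subAtoms C → atN B ∈ subAtoms C
∃-subAtoms (atEx _ _) (here refl) = there (here refl)
∃-subAtoms (atEx _ _) (there (here ()))
∃-subAtoms (atEx _ _) (there (there ()))
∃-subAtoms (atN _)    (here ())
∃-subAtoms (atN _)    (there ())

∃-concatMap-subAtoms : {r : ℕ} {B : Name} (Cs : List Atom) →
                       atEx r B ∈ concatMap subAtoms Cs →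
                       atN B ∈ concatMap subAtoms Cs
∃-concatMap-subAtoms Cs =
  ∈-concatMap⁺ subAtoms ∘ Any.map (λ {C} → ∃-subAtoms C) ∘ ∈-concatMap⁻ subAtoms {xs = Cs}

∃-∉-dissAtoms : {r : ℕ} {B : Name} (ps : List (ℕ × ℕ)) →
                ¬ Any (λ { (X , Y) → atEx r B ∈ atN (var X) ∷ atN (var Y) ∷ [] }) ps
∃-∉-dissAtoms (_ ∷ ps) (here (here ()))
∃-∉-dissAtoms (_ ∷ ps) (here (there (here ())))
∃-∉-dissAtoms (_ ∷ ps) (there ∃∈) = ∃-∉-dissAtoms ps ∃∈

∃-∈At⇒∈At : (Γ : Problem) {r : ℕ} {B : Name} → atEx r B ∈At Γ → atN B ∈At Γ
∃-∈At⇒∈At Γ ∃∈ with ∈-++⁻ (concatMap subsAtoms (subs Γ)) ∃∈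
  where subsAtoms = λ s → concatMap subAtoms (rhs s ∷ lhs s)
... | inj₁ ∃∈subs = ∈-++⁺ˡ (∈-concatMap⁺ _ (Any.map (λ {s} → ∃-concatMap-subAtoms (rhs s ∷ lhs s))
                                                     (∈-concatMap⁻ _ {xs = subs Γ} ∃∈subs)))
... | inj₂ ∃∈diss = ⊥-elim (∃-∉-dissAtoms (diss Γ) (∈-concatMap⁻ _ {xs = diss Γ} ∃∈diss))

σatomF-∃ : (Γ : Problem) (τ : Valuation) (k r : ℕ) (B : Name) →
           σatomF Γ τ k (atEx r B) ≡ ∃ᶜ r (σatomF Γ τ k (atN B))
σatomF-∃ Γ τ k r (var _) = refl
σatomF-∃ Γ τ k r (con _) = refl

module _ (Γ : Problem) (τ : Valuation) (sat : Satisfies Γ τ) where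
  open Satisfies sat

  Descent : ℕ → ℕ → Set
  Descent zero    X = X ∈Nv Γ
  Descent (suc k) X = X ∈Nv Γ × Σ ℕ λ Y → gt τ X Y ≡ true × Descent k Y

  descent-∈Nv : ∀ k {X} → Descent k X → X ∈Nv Γ
  descent-∈Nv zero    X∈ = X∈
  descent-∈Nv (suc k) (X∈ , _) = X∈

  -- Each step removes the start of the chain from a list of all variables
  -- reachable from it; it stays absent from the rest by irreflexivity (Va).
  descent-shorter : ∀ k {X} (L : List Atom) → Descent k X →
                    (∀ {Z} → (Z ≡ X ⊎ gt τ X Z ≡ true) → Z ∈Nv Γ → atN (var Z) ∈ L) →
                    k < length L
  descent-shorter zero L X∈ covers with covers (inj₁ refl) X∈
  ... | X∈L rewrite length-removeAt′ L (index X∈L) = s≤s z≤n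
  descent-shorter (suc k) {X} L (X∈ , Y , X>Y , descent) covers =
    subst (suc k <_) (sym (length-removeAt′ L (index X∈L)))
          (s≤s (descent-shorter k (L ─ X∈L) descent covers′))
    where
    X∈L = covers (inj₁ refl) X∈
    X>Z : ∀ {Z} → Z ∈Nv Γ → Z ≡ Y ⊎ gt τ Y Z ≡ true → gt τ X Z ≡ true
    X>Z Z∈ (inj₁ refl) = X>Y
    X>Z Z∈ (inj₂ Y>Z)  = Vb X Y _ X∈ (descent-∈Nv k descent) Z∈ X>Y Y>Z
    covers′ : ∀ {Z} → (Z ≡ Y ⊎ gt τ Y Z ≡ true) → Z ∈Nv Γ → atN (var Z) ∈ (L ─ X∈L)
    covers′ Z≤Y Z∈ = ∈-─⁺ X∈L (covers (inj₂ (X>Z Z∈ Z≤Y)) Z∈)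
                       λ { refl → not-¬ (X>Z Z∈ Z≤Y) (Va X X∈) }

  no-long-descent : ∀ {X} → ¬ Descent (length (At Γ)) X
  no-long-descent descent = <-irrefl refl (descent-shorter _ (At Γ) descent (λ _ Z∈ → Z∈))

  ∈S⁺ : ∀ {X D} → D ∈Atnv Γ → sub τ (atN (var X)) D ≡ true → D ∈ S Γ τ X
  ∈S⁺ {X} (D∈ , nv) X⊑D = ∈-filterᵇ⁺ (sub τ (atN (var X))) (∈-filterᵇ⁺ nonVar D∈ nv) X⊑D

  ∈S⁻ : ∀ {X D} → D ∈ S Γ τ X → D ∈Atnv Γ × sub τ (atN (var X)) D ≡ true
  ∈S⁻ {X} D∈S with ∈-filterᵇ⁻ (sub τ (atN (var X))) D∈S
  ... | D∈nv , X⊑D = ∈-filterᵇ⁻ nonVar D∈nv , X⊑D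

  -- One more unit of fuel changes nothing as long as no descent of the
  -- current length starts at X, since every variable below X is reached by (Vc).
  σvarF-stable : ∀ k {X} → X ∈Nv Γ → ¬ Descent k X →
                 σvarF Γ τ k X ≡ σvarF Γ τ (suc k) X
  σvarF-stable zero    X∈ ¬descent = ⊥-elim (¬descent X∈)
  σvarF-stable (suc k) {X} X∈ ¬descent =
    cong conj (map-cong-local (tabulate λ D∈S → stable-atom _ (∈S⁻ D∈S)))
    where
    stable-atom : ∀ D → D ∈Atnv Γ × sub τ (atN (var X)) D ≡ true →
                  σatomF Γ τ k D ≡ σatomF Γ τ (suc k) D
    stable-atom (atN (var _))    ((_ , ()) , _)
    stable-atom (atN (con _))    _ = refl
    stable-atom (atEx r (con _)) _ = refl
    stable-atom (atEx r (var Y)) ((D∈ , _) , X⊑D) =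
      cong (∃ᶜ r) (σvarF-stable k Y∈ λ descent → ¬descent (X∈ , Y , Vc X r Y X∈ Y∈ D∈ X⊑D , descent))
      where Y∈ = ∃-∈At⇒∈At Γ D∈

  σ-var : ∀ {X} → X ∈Nv Γ → σ Γ τ (atN (var X)) ≡ conj (map (σ Γ τ) (S Γ τ X))
  σ-var X∈ = σvarF-stable (length (At Γ)) X∈ no-long-descent

  σ-var-⊑ : ∀ {X D} → X ∈Nv Γ → D ∈ S Γ τ X → σ Γ τ (atN (var X)) ⊑ σ Γ τ D
  σ-var-⊑ X∈ D∈S rewrite σ-var X∈ = conj-⊑ (σ Γ τ) D∈S

  ⊑-σ-var : ∀ {Y} F → Y ∈Nv Γ → (∀ {E} → E ∈ S Γ τ Y → F ⊑ σ Γ τ E) → F ⊑ σ Γ τ (atN (var Y))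
  ⊑-σ-var {Y} F Y∈ F⊑S rewrite σ-var Y∈ = ⊑-conj (σ Γ τ) (S Γ τ Y) F F⊑S

  Sound : Atom → Atom → Set₁
  Sound C D = sub τ C D ≡ true → σ Γ τ C ⊑ σ Γ τ D

  sound-from-nonVar : ∀ {C} → C ∈At Γ → (∀ {E} → E ∈Atnv Γ → Sound C E) →
                      ∀ {D} → D ∈At Γ → Sound C D
  sound-from-nonVar {C} C∈ sound-nv {atN (var Y)} Y∈ C⊑Y =
    ⊑-σ-var (σ Γ τ C) Y∈ λ E∈S → let (E∈nv , Y⊑E) = ∈S⁻ E∈S in
      sound-nv E∈nv (III _ _ _ C∈ Y∈ (proj₁ E∈nv) C⊑Y Y⊑E)
  sound-from-nonVar C∈ sound-nv {atN (con b)} D∈ = sound-nv (D∈ , refl)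
  sound-from-nonVar C∈ sound-nv {atEx r B}    D∈ = sound-nv (D∈ , refl)

  sound-name-nonVar : ∀ {A D} → atN A ∈At Γ → D ∈Atnv Γ → Sound (atN A) D
  sound-name-nonVar {var X} X∈ D∈nv X⊑D = σ-var-⊑ X∈ (∈S⁺ D∈nv X⊑D)
  sound-name-nonVar {con a} {atN (con b)} a∈ (b∈ , _) a⊑b with a ℕ.≟ b
  ... | yes refl = ⊑-refl _
  ... | no a≢b   = ⊥-elim (not-¬ a⊑b (IIb a b a∈ b∈ a≢b))
  sound-name-nonVar {con a} {atEx r B} a∈ (D∈ , _) a⊑D = ⊥-elim (not-¬ a⊑D (IId₁ a r B a∈ D∈))

  sound-name : ∀ {A D} → atN A ∈At Γ → D ∈At Γ → Sound (atN A) D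
  sound-name A∈ = sound-from-nonVar A∈ (sound-name-nonVar A∈)

  sound-nonVar : ∀ {C D} → C ∈At Γ → D ∈Atnv Γ → Sound C D
  sound-nonVar {atN A} C∈ D∈nv = sound-name-nonVar C∈ D∈nv
  sound-nonVar {atEx r A} {atN (con b)} C∈ (D∈ , _) C⊑D = ⊥-elim (not-¬ C⊑D (IId₂ b r A D∈ C∈))
  sound-nonVar {atEx r A} {atEx s B} C∈ (D∈ , _) C⊑D with r ℕ.≟ s
  ... | no r≢s   = ⊥-elim (not-¬ C⊑D (IIc r A s B C∈ D∈ r≢s))
  ... | yes refl rewrite σatomF-∃ Γ τ (length (At Γ)) r A | σatomF-∃ Γ τ (length (At Γ)) r B =
    ∃-mono r {σ Γ τ (atN A)} {σ Γ τ (atN B)} (sound-name (∃-∈At⇒∈At Γ C∈) (∃-∈At⇒∈At Γ D∈) (IIe₁ r A B C∈ D∈ C⊑D))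

lemma6p3 : (Γ : Problem) (τ : Valuation) → Satisfies Γ τ →
    (C D : Atom) → C ∈At Γ → D ∈At Γ →
    sub τ C D ≡ true → σ Γ τ C ⊑ σ Γ τ D
lemma6p3 Γ τ sat C D C∈ D∈ = sound-from-nonVar Γ τ sat C∈ (sound-nonVar Γ τ sat C∈) D∈
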